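{- Let $\mathcal L=\{R,G,X,Y\}$ and $S=\{RRX, RXX, RYY, GYX, GXX, YYX, XXX\}$, and let $\mathcal L'=\{G,R,Y\}$ be ordered $G>R>Y$. Then for any $A,B,C\in Forb_c(S)$ with $B\subseteq A,C$, the prioritised amalgamation $A\otimes_B C$ is defined and belongs to $Forb_c(S)$.
   Context: The relations of $\mathcal L$ are binary, symmetric and irreflexive; a structure is complete if any two distinct elements $a,b$ are related by exactly one relation, denoted $\mathbf r(a,b)$. A triangle is a complete structure on three points, specified by the multiset of its edge relations (e.g. $GYX$ has one edge each in $G$, $Y$, $X$). $Forb_c(S)$ is the class of finite complete structures embedding no triangle of $S$. For $B\subseteq A,C$, $A\otimes_B C$ is the complete structure on the disjoint union of $A$ and $C$ over $B$ extending both, in which for $a\in A\setminus B$, $c\in C\setminus B$, $\mathbf r(a,c)$ is the first of $G,R,Y$ (in this order) such that for no $b\in B$ the triangle with edges $\mathbf r(a,b),\mathbf r(b,c),\mathbf r(a,c)$ lies in $S$ ($G$ if $B=\emptyset$). -}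

module Defs where

open import Data.Nat using (ℕ)
import Data.Nat as ℕ
open import Data.Fin using (Fin)
import Data.Fin as Fin
open import Data.Bool using (Bool; true; false; _∧_; _∨_; not; T)
open import Data.Maybe using (Maybe; just; nothing)
open import Data.Sum using (_⊎_; inj₁; inj₂)
open import Data.Product using (_×_)
open import Relation.Binary.PropositionalEquality using (_≡_; _≢_)
open import Relation.Nullary using (¬_)

data L : Set where
  R G X Y : L

eqL : L → L → Bool
eqL R R = true
eqL G G = true
eqL X X = true
eqL Y Y = true
eqL _ _ = false

sameTri : L → L → L → L → L → L → Bool
sameTri x y z p q s =
     (eqL x p ∧ eqL y q ∧ eqL z s)
  ∨ (eqL x p ∧ eqL y s ∧ eqL z q)
  ∨ (eqL x q ∧ eqL y p ∧ eqL z s)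
  ∨ (eqL x q ∧ eqL y s ∧ eqL z p)
  ∨ (eqL x s ∧ eqL y p ∧ eqL z q)
  ∨ (eqL x s ∧ eqL y q ∧ eqL z p)

-- S = {RRX, RXX, RYY, GYX, GXX, YYX, XXX}; inS x y z : the triangle with
-- edge multiset {x,y,z} lies in S
inS : L → L → L → Bool
inS x y z =
     sameTri x y z R R X
  ∨ sameTri x y z R X X
  ∨ sameTri x y z R Y Y
  ∨ sameTri x y z G Y X
  ∨ sameTri x y z G X X
  ∨ sameTri x y z Y Y X
  ∨ sameTri x y z X X X

-- A complete L-structure on a carrier V is a function r : V → V → L
-- (the value on the diagonal is irrelevant), symmetric off the diagonal.
Symmetric : {V : Set} → (V → V → L) → Set
Symmetric {V} r = ∀ (u v : V) → u ≢ v → r u v ≡ r v u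

NoS : {V : Set} → (V → V → L) → Set
NoS {V} r = ∀ (u v w : V) → u ≢ v → v ≢ w → u ≢ w → ¬ T (inS (r u v) (r v w) (r u w))

-- membership in Forb_c(S) (finiteness is ensured by the carriers used below)
InForb : {V : Set} → (V → V → L) → Set
InForb r = Symmetric r × NoS r

-- Setting: B has carrier Fin k; A has carrier Fin k ⊎ Fin m (B = inj₁ part),
-- C has carrier Fin k ⊎ Fin p (B = inj₁ part).

allB : {k : ℕ} → (Fin k → Bool) → Bool
allB {ℕ.zero} f = true
allB {ℕ.suc k} f = f Fin.zero ∧ allB (λ b → f (Fin.suc b))

admissible : {k m p : ℕ} → (Fin k ⊎ Fin m → Fin k ⊎ Fin m → L)
           → (Fin k ⊎ Fin p → Fin k ⊎ Fin p → L) → Fin m → Fin p → L → Bool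
admissible rA rC a c ℓ = allB (λ b → not (inS (rA (inj₂ a) (inj₁ b)) (rC (inj₁ b) (inj₂ c)) ℓ))

prio : {k m p : ℕ} → (Fin k ⊎ Fin m → Fin k ⊎ Fin m → L)
     → (Fin k ⊎ Fin p → Fin k ⊎ Fin p → L) → Fin m → Fin p → Maybe L
prio rA rC a c with admissible rA rC a c G | admissible rA rC a c R | admissible rA rC a c Y
... | true  | _     | _     = just G
... | false | true  | _     = just R
... | false | false | true  = just Y
... | false | false | false = nothing

-- The prioritised amalgam A ⊗_B C on the carrier Fin k ⊎ (Fin m ⊎ Fin p)
-- (B, A∖B, C∖B); `nothing` marks an undefined edge.
amalg : {k m p : ℕ} → (Fin k ⊎ Fin m → Fin k ⊎ Fin m → L)
      → (Fin k ⊎ Fin p → Fin k ⊎ Fin p → L)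
      → (Fin k ⊎ (Fin m ⊎ Fin p)) → (Fin k ⊎ (Fin m ⊎ Fin p)) → Maybe L
amalg rA rC (inj₁ b)        (inj₁ b')        = just (rA (inj₁ b) (inj₁ b'))
amalg rA rC (inj₁ b)        (inj₂ (inj₁ a))  = just (rA (inj₁ b) (inj₂ a))
amalg rA rC (inj₂ (inj₁ a)) (inj₁ b)         = just (rA (inj₂ a) (inj₁ b))
amalg rA rC (inj₂ (inj₁ a)) (inj₂ (inj₁ a')) = just (rA (inj₂ a) (inj₂ a'))
amalg rA rC (inj₁ b)        (inj₂ (inj₂ c))  = just (rC (inj₁ b) (inj₂ c))
amalg rA rC (inj₂ (inj₂ c)) (inj₁ b)         = just (rC (inj₂ c) (inj₁ b))
amalg rA rC (inj₂ (inj₂ c)) (inj₂ (inj₂ c')) = just (rC (inj₂ c) (inj₂ c'))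
amalg rA rC (inj₂ (inj₁ a)) (inj₂ (inj₂ c))  = prio rA rC a c
amalg rA rC (inj₂ (inj₂ c)) (inj₂ (inj₁ a))  = prio rA rC a c

module Submission where

-- Say that b ∈ B blocks ℓ on a pair (a, c) ∈ (A∖B) × (C∖B) if the triangle
-- r(a,b), r(b,c), ℓ lies in S; the amalgam puts on (a, c) the first of G, R, Y
-- that no b blocks.  Everything the argument needs about S is a handful of
-- statements about at most six relation symbols, verified by exhaustively
-- evaluating a Boolean test on all assignments.  With them:
--  * the amalgam is defined: if G, R, Y were all blocked, a blocker of G also
--    blocks R or Y, and the two blockers involved would span, together with a
--    and c, triangles in A or in C lying in S;
--  * it avoids S: triangles inside A or inside C are inherited, a triangle
--    a b c avoids S by admissibility, and a triangle with two amalgam edges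
--    either has two G edges (never in S) or one of its amalgam edges is
--    G-blocked by some b, and then a general four-point lemma, applied to the
--    four vertices consisting of b and the triangle, rules it out.

open import Defs
open import Data.Nat using (ℕ; zero; suc)
open import Data.Fin using (Fin)
import Data.Fin as Fin
open import Data.Fin.Properties using (_≟_)
open import Data.Vec using (Vec; []; _∷_)
open import Data.Sum using (_⊎_; inj₁; inj₂; [_,_]′)
open import Data.Sum.Properties using (inj₁-injective)
open import Data.Product using (∃; Σ; _×_; _,_; proj₁; proj₂)
open import Data.Maybe using (just)
open import Data.Bool using (Bool; true; false; _∧_; _∨_; not; T)
open import Data.Bool.Properties using (T-∨)
open import Data.Unit using (tt)
open import Data.Empty using (⊥-elim)
open import Function using (_∘_)
open import Function.Bundles using (module Equivalence)
open import Relation.Nullary using (¬_; yes; no)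
open import Relation.Nullary.Decidable using (T?; decidable-stable)
open import Relation.Binary.PropositionalEquality
  using (_≡_; _≢_; ≢-sym; refl; sym; cong; subst; subst₂)

open Equivalence using (to)

infixr 4 _⇒_
_⇒_ : Bool → Bool → Bool
a ⇒ b = not a ∨ b

modus-ponens : ∀ {a b} → T (a ⇒ b) → T a → T b
modus-ponens {true} t _ = t

T-not : ∀ {a} → ¬ T a → T (not a)
T-not {true} ¬t = ¬t tt
T-not {false} _ = tt

T-not⁻ : ∀ {a} → T (not a) → ¬ T a
T-not⁻ {true} ()

¬T-not : ∀ {a} → ¬ T (not a) → T a
¬T-not {true} _ = tt
¬T-not {false} ¬t = ¬t tt

∧-fst : ∀ a {b} → T (a ∧ b) → T a
∧-fst true _ = tt

∧-snd : ∀ a {b} → T (a ∧ b) → T b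
∧-snd true t = t

∧-intro : ∀ {a b} → T a → T b → T (a ∧ b)
∧-intro {true} _ t = t

true⇒T : ∀ {a} → a ≡ true → T a
true⇒T refl = tt

false⇒¬T : ∀ {a} → a ≡ false → ¬ T a
false⇒¬T refl ()

allB-sound : ∀ {n} (f : Fin n → Bool) → T (allB f) → ∀ i → T (f i)
allB-sound f t Fin.zero = ∧-fst (f Fin.zero) t
allB-sound f t (Fin.suc i) = allB-sound (f ∘ Fin.suc) (∧-snd (f Fin.zero) t) i

allB-counterexample : ∀ {n} (f : Fin n → Bool) → ¬ T (allB f) → ∃ λ i → ¬ T (f i)
allB-counterexample {zero} f ¬all = ⊥-elim (¬all tt)
allB-counterexample {suc n} f ¬all with T? (f Fin.zero)
... | no ¬f₀ = Fin.zero , ¬f₀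
... | yes f₀ =
  let (i , ¬fi) = allB-counterexample (f ∘ Fin.suc) (¬all ∘ ∧-intro f₀)
  in Fin.suc i , ¬fi

everyL : (L → Bool) → Bool
everyL g = g R ∧ g G ∧ g X ∧ g Y

everyL-sound : ∀ g → T (everyL g) → ∀ x → T (g x)
everyL-sound g t R = ∧-fst (g R) t
everyL-sound g t G = ∧-fst (g G) (∧-snd (g R) t)
everyL-sound g t X = ∧-fst (g X) (∧-snd (g G) (∧-snd (g R) t))
everyL-sound g t Y = ∧-snd (g X) (∧-snd (g G) (∧-snd (g R) t))

allAssignments : (n : ℕ) → (Vec L n → Bool) → Bool
allAssignments zero f = f []
allAssignments (suc n) f = everyL (λ x → allAssignments n (λ v → f (x ∷ v)))

allAssignments-sound : ∀ n f → T (allAssignments n f) → ∀ v → T (f v)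
allAssignments-sound zero f t [] = t
allAssignments-sound (suc n) f t (x ∷ v) =
  allAssignments-sound n (λ v → f (x ∷ v)) (everyL-sound (λ x → allAssignments n (λ v → f (x ∷ v))) t x) v

-- Proof by exhaustion: the implicit certificate reduces to ⊤ when the test
-- succeeds on every assignment, and is then filled in automatically.
by-exhaustion : ∀ n (f : Vec L n → Bool) {_ : T (allAssignments n f)} → ∀ v → T (f v)
by-exhaustion n f {t} = allAssignments-sound n f t

inS-swap₂₃ : ∀ x y z → T (inS x y z) → T (inS x z y)
inS-swap₂₃ x y z = modus-ponens
  (by-exhaustion 3 (λ { (x ∷ y ∷ z ∷ []) → inS x y z ⇒ inS x z y }) (x ∷ y ∷ z ∷ []))

inS-swap₁₃ : ∀ x y z → T (inS x y z) → T (inS z y x)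
inS-swap₁₃ x y z = modus-ponens
  (by-exhaustion 3 (λ { (x ∷ y ∷ z ∷ []) → inS x y z ⇒ inS z y x }) (x ∷ y ∷ z ∷ []))

no-two-G : ∀ z → ¬ T (inS G G z)
no-two-G z = T-not⁻ (by-exhaustion 1 (λ { (z ∷ []) → not (inS G G z) }) (z ∷ []))

data Complementary : L → L → Set where
  RY : Complementary R Y
  YR : Complementary Y R

-- A pair of relations blocking G (it is XX, XY or YX) also blocks R or Y ...
G-blocker-blocks-R-or-Y : ∀ x y → T (inS x y G) → T (inS x y R) ⊎ T (inS x y Y)
G-blocker-blocks-R-or-Y x y blocksG = to T-∨ (modus-ponens
  (by-exhaustion 2 (λ { (x ∷ y ∷ []) → inS x y G ⇒ inS x y R ∨ inS x y Y }) (x ∷ y ∷ []))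
  blocksG)

no-total-blocker : ∀ {ℓ ℓ'} → Complementary ℓ ℓ' → ∀ x y
  → T (inS x y G) → T (inS x y ℓ) → ¬ T (inS x y ℓ')
no-total-blocker RY x y blocksG blocksR = T-not⁻ (modus-ponens (modus-ponens
  (by-exhaustion 2 (λ { (x ∷ y ∷ []) → inS x y G ⇒ inS x y R ⇒ not (inS x y Y) }) (x ∷ y ∷ []))
  blocksG) blocksR)
no-total-blocker YR x y blocksG blocksY blocksR = no-total-blocker RY x y blocksG blocksR blocksY

-- Two points b₁ ≠ b₂ with r(a,bᵢ) = xᵢ, r(bᵢ,c) = yᵢ, r(b₁,b₂) = z, whose
-- triangles a b₁ b₂ and b₁ b₂ c avoid S: if b₁ blocks G and ℓ, b₂ does not
-- block the complementary ℓ'.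
split-blockers : ∀ {ℓ ℓ'} → Complementary ℓ ℓ' → ∀ x₁ y₁ x₂ y₂ z
  → ¬ T (inS x₁ z x₂) → ¬ T (inS z y₂ y₁)
  → T (inS x₁ y₁ G) → T (inS x₁ y₁ ℓ) → ¬ T (inS x₂ y₂ ℓ')
split-blockers {ℓ} {ℓ'} pair x₁ y₁ x₂ y₂ z ¬ab₁b₂ ¬b₁b₂c blocksG blocksℓ =
  T-not⁻ (modus-ponens (modus-ponens (modus-ponens (modus-ponens
    (valid pair (x₁ ∷ y₁ ∷ x₂ ∷ y₂ ∷ z ∷ []))
    (T-not ¬ab₁b₂)) (T-not ¬b₁b₂c)) blocksG) blocksℓ)
  where
  test : L → L → Vec L 5 → Bool
  test ℓ ℓ' (x₁ ∷ y₁ ∷ x₂ ∷ y₂ ∷ z ∷ []) =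
    not (inS x₁ z x₂) ⇒ not (inS z y₂ y₁) ⇒ inS x₁ y₁ G ⇒ inS x₁ y₁ ℓ ⇒ not (inS x₂ y₂ ℓ')
  valid : Complementary ℓ ℓ' → ∀ v → T (test ℓ ℓ' v)
  valid RY = by-exhaustion 5 (test R Y)
  valid YR = by-exhaustion 5 (test Y R)

inL′ : L → Bool
inL′ X = false
inL′ _ = true

-- Four points b, o, p, q with r(b,o) = o, r(b,p) = p, r(b,q) = q, r(p,q) = z,
-- r(o,p) = l and r(o,q) = m ∈ L': if the triangles b p q, b o p, b o q avoid
-- S and r(q,b), r(b,o), G is in S, then the triangle o p q avoids S.
four-point-relations : ∀ o p q z l m → ¬ T (inS p z q) → ¬ T (inS o l p) → ¬ T (inS o m q)
  → T (inS q o G) → T (inL′ m) → ¬ T (inS l z m)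
four-point-relations o p q z l m ¬bpq ¬bop ¬boq blocksG m∈L′ =
  T-not⁻ (modus-ponens (modus-ponens (modus-ponens (modus-ponens (modus-ponens
    (by-exhaustion 6 test (o ∷ p ∷ q ∷ z ∷ l ∷ m ∷ []))
    (T-not ¬bpq)) (T-not ¬bop)) (T-not ¬boq)) blocksG) m∈L′)
  where
  test : Vec L 6 → Bool
  test (o ∷ p ∷ q ∷ z ∷ l ∷ m ∷ []) =
    not (inS p z q) ⇒ not (inS o l p) ⇒ not (inS o m q) ⇒ inS q o G ⇒ inL′ m ⇒ not (inS l z m)

AvoidsS : {V : Set} → (V → V → L) → V → V → V → Set
AvoidsS r u v w = u ≢ v → v ≢ w → u ≢ w → ¬ T (inS (r u v) (r v w) (r u w))

avoids-swap₁₂ : ∀ {V} {r : V → V → L} → Symmetric r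
  → ∀ {u v w} → AvoidsS r u v w → AvoidsS r v u w
avoids-swap₁₂ {r = r} r-sym {u} {v} {w} uvw v≢u u≢w v≢w t =
  uvw (≢-sym v≢u) v≢w u≢w (inS-swap₂₃ (r u v) (r u w) (r v w)
    (subst (λ e → T (inS e (r u w) (r v w))) (r-sym v u v≢u) t))

avoids-swap₂₃ : ∀ {V} {r : V → V → L} → Symmetric r
  → ∀ {u v w} → AvoidsS r u v w → AvoidsS r u w v
avoids-swap₂₃ {r = r} r-sym {u} {v} {w} uvw u≢w w≢v u≢v t =
  uvw u≢v (≢-sym w≢v) u≢w (inS-swap₁₃ (r u w) (r v w) (r u v)
    (subst (λ e → T (inS (r u w) e (r u v))) (r-sym w v w≢v) t))

embed-avoids : ∀ {W V} (s : W → W → L) (r : V → V → L) (e : W → V)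
  → (∀ x y → r (e x) (e y) ≡ s x y) → NoS s
  → ∀ x y z → AvoidsS r (e x) (e y) (e z)
embed-avoids s r e restricts noS x y z ex≢ey ey≢ez ex≢ez
  rewrite restricts x y | restricts y z | restricts x z =
  noS x y z (ex≢ey ∘ cong e) (ey≢ez ∘ cong e) (ex≢ez ∘ cong e)

four-point : ∀ {V} (r : V → V → L) → Symmetric r → ∀ b o p q
  → b ≢ o → b ≢ p → b ≢ q
  → AvoidsS r b p q → AvoidsS r b o p → AvoidsS r b o q
  → T (inS (r q b) (r b o) G) → T (inL′ (r o q))
  → AvoidsS r o p q
four-point r r-sym b o p q b≢o b≢p b≢q bpq bop boq blocksG o–q∈L′ o≢p p≢q o≢q =
  four-point-relations (r b o) (r b p) (r b q) (r p q) (r o p) (r o q)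
    (bpq b≢p p≢q b≢q) (bop b≢o o≢p b≢p) (boq b≢o o≢q b≢q)
    (subst (λ e → T (inS e (r b o) G)) (r-sym q b (≢-sym b≢q)) blocksG)
    o–q∈L′

prioritised : Bool → Bool → L
prioritised true _ = G
prioritised false true = R
prioritised false false = Y

prioritised-in-L′ : ∀ g r → T (inL′ (prioritised g r))
prioritised-in-L′ true _ = tt
prioritised-in-L′ false true = tt
prioritised-in-L′ false false = tt

module Amalgam (k m p : ℕ)
    (rA : Fin k ⊎ Fin m → Fin k ⊎ Fin m → L)
    (rC : Fin k ⊎ Fin p → Fin k ⊎ Fin p → L)
    (A-forb : InForb rA) (C-forb : InForb rC)
    (agreeB : ∀ (b b' : Fin k) → rA (inj₁ b) (inj₁ b') ≡ rC (inj₁ b) (inj₁ b')) where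

  V : Set
  V = Fin k ⊎ (Fin m ⊎ Fin p)

  fromA : Fin k ⊎ Fin m → V
  fromA (inj₁ b) = inj₁ b
  fromA (inj₂ a) = inj₂ (inj₁ a)

  fromC : Fin k ⊎ Fin p → V
  fromC (inj₁ b) = inj₁ b
  fromC (inj₂ c) = inj₂ (inj₂ c)

  toA : Fin m → Fin k → L
  toA a b = rA (inj₂ a) (inj₁ b)

  toC : Fin k → Fin p → L
  toC b c = rC (inj₁ b) (inj₂ c)

  blocks : Fin m → Fin p → L → Fin k → Bool
  blocks a c ℓ b = inS (toA a b) (toC b c) ℓ

  Blocks : Fin m → Fin p → Fin k → L → Set
  Blocks a c b ℓ = T (blocks a c ℓ b)

  adm : Fin m → Fin p → L → Bool
  adm = admissible rA rC

  admissible-sound : ∀ a c ℓ → T (adm a c ℓ) → ∀ b → ¬ Blocks a c b ℓ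
  admissible-sound a c ℓ t b = T-not⁻ (allB-sound (not ∘ blocks a c ℓ) t b)

  blocker : ∀ a c ℓ → ¬ T (adm a c ℓ) → ∃ λ b → Blocks a c b ℓ
  blocker a c ℓ ¬adm with allB-counterexample (not ∘ blocks a c ℓ) ¬adm
  ... | b , ¬notBlocks = b , ¬T-not ¬notBlocks

  choice : Fin m → Fin p → L
  choice a c = prioritised (adm a c G) (adm a c R)

  amalgam : V → V → L
  amalgam (inj₁ b) (inj₁ b') = rA (inj₁ b) (inj₁ b')
  amalgam (inj₁ b) (inj₂ (inj₁ a)) = rA (inj₁ b) (inj₂ a)
  amalgam (inj₂ (inj₁ a)) (inj₁ b) = rA (inj₂ a) (inj₁ b)
  amalgam (inj₂ (inj₁ a)) (inj₂ (inj₁ a')) = rA (inj₂ a) (inj₂ a')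
  amalgam (inj₁ b) (inj₂ (inj₂ c)) = rC (inj₁ b) (inj₂ c)
  amalgam (inj₂ (inj₂ c)) (inj₁ b) = rC (inj₂ c) (inj₁ b)
  amalgam (inj₂ (inj₂ c)) (inj₂ (inj₂ c')) = rC (inj₂ c) (inj₂ c')
  amalgam (inj₂ (inj₁ a)) (inj₂ (inj₂ c)) = choice a c
  amalgam (inj₂ (inj₂ c)) (inj₂ (inj₁ a)) = choice a c

  amalgam-symmetric : Symmetric amalgam
  amalgam-symmetric (inj₁ b) (inj₁ b') ne = proj₁ A-forb (inj₁ b) (inj₁ b') (ne ∘ cong fromA)
  amalgam-symmetric (inj₁ b) (inj₂ (inj₁ a)) _ = proj₁ A-forb (inj₁ b) (inj₂ a) (λ ())
  amalgam-symmetric (inj₂ (inj₁ a)) (inj₁ b) _ = proj₁ A-forb (inj₂ a) (inj₁ b) (λ ())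
  amalgam-symmetric (inj₂ (inj₁ a)) (inj₂ (inj₁ a')) ne = proj₁ A-forb (inj₂ a) (inj₂ a') (ne ∘ cong fromA)
  amalgam-symmetric (inj₁ b) (inj₂ (inj₂ c)) _ = proj₁ C-forb (inj₁ b) (inj₂ c) (λ ())
  amalgam-symmetric (inj₂ (inj₂ c)) (inj₁ b) _ = proj₁ C-forb (inj₂ c) (inj₁ b) (λ ())
  amalgam-symmetric (inj₂ (inj₂ c)) (inj₂ (inj₂ c')) ne = proj₁ C-forb (inj₂ c) (inj₂ c') (ne ∘ cong fromC)
  amalgam-symmetric (inj₂ (inj₁ a)) (inj₂ (inj₂ c)) _ = refl
  amalgam-symmetric (inj₂ (inj₂ c)) (inj₂ (inj₁ a)) _ = refl

  A-avoids : ∀ x y z → AvoidsS amalgam (fromA x) (fromA y) (fromA z)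
  A-avoids = embed-avoids rA amalgam fromA restricts (proj₂ A-forb)
    where
    restricts : ∀ x y → amalgam (fromA x) (fromA y) ≡ rA x y
    restricts (inj₁ _) (inj₁ _) = refl
    restricts (inj₁ _) (inj₂ _) = refl
    restricts (inj₂ _) (inj₁ _) = refl
    restricts (inj₂ _) (inj₂ _) = refl

  C-avoids : ∀ x y z → AvoidsS amalgam (fromC x) (fromC y) (fromC z)
  C-avoids = embed-avoids rC amalgam fromC restricts (proj₂ C-forb)
    where
    restricts : ∀ x y → amalgam (fromC x) (fromC y) ≡ rC x y
    restricts (inj₁ b) (inj₁ b') = agreeB b b'
    restricts (inj₁ _) (inj₂ _) = refl
    restricts (inj₂ _) (inj₁ _) = refl
    restricts (inj₂ _) (inj₂ _) = refl

  blockers-incompatible : ∀ a c {ℓ ℓ'} → Complementary ℓ ℓ' → ∀ b₁ b₂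
    → Blocks a c b₁ G → Blocks a c b₁ ℓ → ¬ Blocks a c b₂ ℓ'
  blockers-incompatible a c pair b₁ b₂ blocksG blocksℓ with b₁ ≟ b₂
  ... | yes refl = no-total-blocker pair (toA a b₁) (toC b₁ c) blocksG blocksℓ
  ... | no b₁≢b₂ =
    split-blockers pair (toA a b₁) (toC b₁ c) (toA a b₂) (toC b₂ c) (rA (inj₁ b₁) (inj₁ b₂))
      (A-avoids (inj₂ a) (inj₁ b₁) (inj₁ b₂) (λ ()) b₁≢b₂′ (λ ()))
      (C-avoids (inj₁ b₁) (inj₁ b₂) (inj₂ c) b₁≢b₂′ (λ ()) (λ ()))
      blocksG blocksℓ
    where
    b₁≢b₂′ : inj₁ b₁ ≢ inj₁ b₂
    b₁≢b₂′ = b₁≢b₂ ∘ inj₁-injective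

  Y-admissible : ∀ a c → ¬ T (adm a c G) → ¬ T (adm a c R) → T (adm a c Y)
  Y-admissible a c ¬admG ¬admR = decidable-stable (T? (adm a c Y)) λ ¬admY →
    let (bG , blocksG) = blocker a c G ¬admG
        (bR , blocksR) = blocker a c R ¬admR
        (bY , blocksY) = blocker a c Y ¬admY
    in [ (λ blocksGR → blockers-incompatible a c RY bG bY blocksG blocksGR blocksY)
       , (λ blocksGY → blockers-incompatible a c YR bG bR blocksG blocksGY blocksR)
       ]′ (G-blocker-blocks-R-or-Y (toA a bG) (toC bG c) blocksG)

  prio-choice : ∀ a c → prio rA rC a c ≡ just (choice a c)
  prio-choice a c with adm a c G in eG | adm a c R in eR | adm a c Y in eY
  ... | true  | _     | _     = refl
  ... | false | true  | _     = refl
  ... | false | false | true  = refl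
  ... | false | false | false = ⊥-elim (false⇒¬T eY (Y-admissible a c (false⇒¬T eG) (false⇒¬T eR)))

  choice-admissible : ∀ a c → T (adm a c (choice a c))
  choice-admissible a c with adm a c G in eG | adm a c R in eR
  ... | true  | _     = true⇒T eG
  ... | false | true  = true⇒T eR
  ... | false | false = Y-admissible a c (false⇒¬T eG) (false⇒¬T eR)

  choice-G-or-blocked : ∀ a c → choice a c ≡ G ⊎ ∃ λ b → Blocks a c b G
  choice-G-or-blocked a c with adm a c G in eG
  ... | true  = inj₁ refl
  ... | false = inj₂ (blocker a c G (false⇒¬T eG))

  amalgam-defined : ∀ u v → u ≢ v → amalg rA rC u v ≡ just (amalgam u v)
  amalgam-defined (inj₁ _) (inj₁ _) _ = refl
  amalgam-defined (inj₁ _) (inj₂ (inj₁ _)) _ = refl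
  amalgam-defined (inj₂ (inj₁ _)) (inj₁ _) _ = refl
  amalgam-defined (inj₂ (inj₁ _)) (inj₂ (inj₁ _)) _ = refl
  amalgam-defined (inj₁ _) (inj₂ (inj₂ _)) _ = refl
  amalgam-defined (inj₂ (inj₂ _)) (inj₁ _) _ = refl
  amalgam-defined (inj₂ (inj₂ _)) (inj₂ (inj₂ _)) _ = refl
  amalgam-defined (inj₂ (inj₁ a)) (inj₂ (inj₂ c)) _ = prio-choice a c
  amalgam-defined (inj₂ (inj₂ c)) (inj₂ (inj₁ a)) _ = prio-choice a c

  vB : Fin k → V
  vB = inj₁

  vA : Fin m → V
  vA = inj₂ ∘ inj₁

  vC : Fin p → V
  vC = inj₂ ∘ inj₂

  swap₁₂ : ∀ {u v w} → AvoidsS amalgam u v w → AvoidsS amalgam v u w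
  swap₁₂ = avoids-swap₁₂ amalgam-symmetric

  swap₂₃ : ∀ {u v w} → AvoidsS amalgam u v w → AvoidsS amalgam u w v
  swap₂₃ = avoids-swap₂₃ amalgam-symmetric

  reverse : ∀ {u v w} → AvoidsS amalgam u v w → AvoidsS amalgam w v u
  reverse = swap₁₂ ∘ swap₂₃ ∘ swap₁₂

  -- A triangle a b c avoids S because the relation chosen on (a, c) is admissible.
  mixed-avoids : ∀ a b c → AvoidsS amalgam (vA a) (vB b) (vC c)
  mixed-avoids a b c _ _ _ = admissible-sound a c (choice a c) (choice-admissible a c) b

  mixed-avoids′ : ∀ a b c → AvoidsS amalgam (vB b) (vC c) (vA a)
  mixed-avoids′ a b c = swap₂₃ (swap₁₂ (mixed-avoids a b c))

  blocked-edge-avoids : ∀ a c b w → Blocks a c b G → vB b ≢ w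
    → AvoidsS amalgam (vB b) w (vA a) → AvoidsS amalgam (vB b) (vC c) w
    → AvoidsS amalgam (vA a) (vC c) w
  blocked-edge-avoids a c b w blocksG b≢w bwa bcw = swap₂₃ (reverse
    (four-point amalgam amalgam-symmetric (vB b) (vC c) w (vA a) (λ ()) b≢w (λ ())
      bwa bcw (mixed-avoids′ a b c) blocksG (prioritised-in-L′ _ _)))

  -- Triangles with two amalgam edges: either one of them is G-blocked, or
  -- both are G.
  AAC-avoids : ∀ a c a' → AvoidsS amalgam (vA a) (vC c) (vA a')
  AAC-avoids a c a' with choice-G-or-blocked a c | choice-G-or-blocked a' c
  ... | inj₂ (b , blocksG) | _ = blocked-edge-avoids a c b (vA a') blocksG (λ ())
    (A-avoids (inj₁ b) (inj₂ a') (inj₂ a)) (mixed-avoids′ a' b c)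
  ... | inj₁ _ | inj₂ (b , blocksG) = reverse (blocked-edge-avoids a' c b (vA a) blocksG (λ ())
    (A-avoids (inj₁ b) (inj₂ a) (inj₂ a')) (mixed-avoids′ a b c))
  ... | inj₁ acG | inj₁ a'cG = λ _ _ _ →
    subst₂ (λ l l' → ¬ T (inS l l' _)) (sym acG) (sym a'cG) (no-two-G (rA (inj₂ a) (inj₂ a')))

  ACC-avoids : ∀ a c c' → AvoidsS amalgam (vC c) (vA a) (vC c')
  ACC-avoids a c c' with choice-G-or-blocked a c | choice-G-or-blocked a c'
  ... | inj₂ (b , blocksG) | _ = swap₁₂ (blocked-edge-avoids a c b (vC c') blocksG (λ ())
    (mixed-avoids′ a b c') (C-avoids (inj₁ b) (inj₂ c) (inj₂ c')))
  ... | inj₁ _ | inj₂ (b , blocksG) = reverse (swap₁₂ (blocked-edge-avoids a c' b (vC c) blocksG (λ ())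
    (mixed-avoids′ a b c) (C-avoids (inj₁ b) (inj₂ c') (inj₂ c))))
  ... | inj₁ acG | inj₁ ac'G = λ _ _ _ →
    subst₂ (λ l l' → ¬ T (inS l l' _)) (sym acG) (sym ac'G) (no-two-G (rC (inj₂ c) (inj₂ c')))

  amalgam-avoids : NoS amalgam
  amalgam-avoids (inj₁ x) (inj₁ y) (inj₁ z) = A-avoids (inj₁ x) (inj₁ y) (inj₁ z)
  amalgam-avoids (inj₁ x) (inj₁ y) (inj₂ (inj₁ z)) = A-avoids (inj₁ x) (inj₁ y) (inj₂ z)
  amalgam-avoids (inj₁ x) (inj₂ (inj₁ y)) (inj₁ z) = A-avoids (inj₁ x) (inj₂ y) (inj₁ z)
  amalgam-avoids (inj₁ x) (inj₂ (inj₁ y)) (inj₂ (inj₁ z)) = A-avoids (inj₁ x) (inj₂ y) (inj₂ z)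
  amalgam-avoids (inj₂ (inj₁ x)) (inj₁ y) (inj₁ z) = A-avoids (inj₂ x) (inj₁ y) (inj₁ z)
  amalgam-avoids (inj₂ (inj₁ x)) (inj₁ y) (inj₂ (inj₁ z)) = A-avoids (inj₂ x) (inj₁ y) (inj₂ z)
  amalgam-avoids (inj₂ (inj₁ x)) (inj₂ (inj₁ y)) (inj₁ z) = A-avoids (inj₂ x) (inj₂ y) (inj₁ z)
  amalgam-avoids (inj₂ (inj₁ x)) (inj₂ (inj₁ y)) (inj₂ (inj₁ z)) = A-avoids (inj₂ x) (inj₂ y) (inj₂ z)
  amalgam-avoids (inj₁ x) (inj₁ y) (inj₂ (inj₂ z)) = C-avoids (inj₁ x) (inj₁ y) (inj₂ z)
  amalgam-avoids (inj₁ x) (inj₂ (inj₂ y)) (inj₁ z) = C-avoids (inj₁ x) (inj₂ y) (inj₁ z)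
  amalgam-avoids (inj₁ x) (inj₂ (inj₂ y)) (inj₂ (inj₂ z)) = C-avoids (inj₁ x) (inj₂ y) (inj₂ z)
  amalgam-avoids (inj₂ (inj₂ x)) (inj₁ y) (inj₁ z) = C-avoids (inj₂ x) (inj₁ y) (inj₁ z)
  amalgam-avoids (inj₂ (inj₂ x)) (inj₁ y) (inj₂ (inj₂ z)) = C-avoids (inj₂ x) (inj₁ y) (inj₂ z)
  amalgam-avoids (inj₂ (inj₂ x)) (inj₂ (inj₂ y)) (inj₁ z) = C-avoids (inj₂ x) (inj₂ y) (inj₁ z)
  amalgam-avoids (inj₂ (inj₂ x)) (inj₂ (inj₂ y)) (inj₂ (inj₂ z)) = C-avoids (inj₂ x) (inj₂ y) (inj₂ z)
  amalgam-avoids (inj₂ (inj₁ a)) (inj₁ b) (inj₂ (inj₂ c)) = mixed-avoids a b c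
  amalgam-avoids (inj₂ (inj₁ a)) (inj₂ (inj₂ c)) (inj₁ b) = swap₂₃ (mixed-avoids a b c)
  amalgam-avoids (inj₁ b) (inj₂ (inj₁ a)) (inj₂ (inj₂ c)) = swap₁₂ (mixed-avoids a b c)
  amalgam-avoids (inj₁ b) (inj₂ (inj₂ c)) (inj₂ (inj₁ a)) = mixed-avoids′ a b c
  amalgam-avoids (inj₂ (inj₂ c)) (inj₂ (inj₁ a)) (inj₁ b) = swap₁₂ (swap₂₃ (mixed-avoids a b c))
  amalgam-avoids (inj₂ (inj₂ c)) (inj₁ b) (inj₂ (inj₁ a)) = reverse (mixed-avoids a b c)
  amalgam-avoids (inj₂ (inj₁ a)) (inj₂ (inj₂ c)) (inj₂ (inj₁ a')) = AAC-avoids a c a'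
  amalgam-avoids (inj₂ (inj₁ a)) (inj₂ (inj₁ a')) (inj₂ (inj₂ c)) = swap₂₃ (AAC-avoids a c a')
  amalgam-avoids (inj₂ (inj₂ c)) (inj₂ (inj₁ a)) (inj₂ (inj₁ a')) = swap₁₂ (AAC-avoids a c a')
  amalgam-avoids (inj₂ (inj₂ c)) (inj₂ (inj₁ a)) (inj₂ (inj₂ c')) = ACC-avoids a c c'
  amalgam-avoids (inj₂ (inj₁ a)) (inj₂ (inj₂ c)) (inj₂ (inj₂ c')) = swap₁₂ (ACC-avoids a c c')
  amalgam-avoids (inj₂ (inj₂ c)) (inj₂ (inj₂ c')) (inj₂ (inj₁ a)) = swap₂₃ (ACC-avoids a c c')

lemma6p9 : (k m p : ℕ)
    → (rA : Fin k ⊎ Fin m → Fin k ⊎ Fin m → L)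
    → (rC : Fin k ⊎ Fin p → Fin k ⊎ Fin p → L)
    → InForb rA
    → InForb rC
    → (∀ (b b' : Fin k) → rA (inj₁ b) (inj₁ b') ≡ rC (inj₁ b) (inj₁ b'))
    → Σ (Fin k ⊎ (Fin m ⊎ Fin p) → Fin k ⊎ (Fin m ⊎ Fin p) → L) (λ r →
        (∀ u v → u ≢ v → amalg rA rC u v ≡ just (r u v)) × InForb r)
lemma6p9 k m p rA rC A-forb C-forb agreeB =
  amalgam , amalgam-defined , amalgam-symmetric , amalgam-avoids
  where open Amalgam k m p rA rC A-forb C-forb agreeB
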